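{- Let $s<t$ be relatively prime positive integers. Let $\beta,\gamma$ be $(s,t)$-closed beta-sets and $k$ a positive integer such that $\beta\prec\gamma$, $|\overline{\beta+k}|-|\beta|\ge|\overline{\gamma+k}|-|\gamma|$, and $|\gamma|\ge|\overline{\beta+k}|$. Then $\overline{\beta+k}\prec\overline{\gamma+k}$.
   Context: A beta-set is a finite set of positive integers written decreasingly $\{\beta_1>\dots>\beta_n\}$, with associated partition $P(\beta)=(\beta_1-(n-1),\dots,\beta_n)$. For partitions $P=(P_1,\dots,P_n)$, $Q=(Q_1,\dots,Q_m)$ write $P<Q$ if $n\le m$ and $P_i\le Q_i$ for $i\le n$; $\beta\prec\gamma$ means $P(\beta)<P(\gamma)$. $\beta$ is $(s,t)$-closed if for every $x\in\beta$: $x>s\Rightarrow x-s\in\beta$, $x>t\Rightarrow x-t\in\beta$. The $(s,t)$-closure of a set $\beta$ of positive integers is $\overline{\beta}=\{x-as-bt: x\in\beta,\ a,b\ge0,\ x>as+bt\}$; $\beta+k=\{x+k:x\in\beta\}$. -}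

module Defs where

open import Data.Nat using (ℕ; zero; suc; _+_; _*_; _∸_; _≤_; _<_; _>_)
open import Data.List using (List; []; _∷_; length; map)
open import Data.List.Membership.Propositional using (_∈_)
open import Data.List.Relation.Unary.All using (All)
open import Data.List.Relation.Unary.Linked using (Linked)
open import Data.Product using (_×_; ∃; ∃-syntax)
open import Relation.Binary.PropositionalEquality using (_≡_)

-- A beta-set is represented by the list of its elements written decreasingly:
-- strictly decreasing list of positive integers.
IsBetaSet : List ℕ → Set
IsBetaSet β = Linked _>_ β × All (λ x → 0 < x) β

-- Associated partition: P(β)_i = β_i - (n - i)  (1-indexed), i.e. each element
-- minus the number of elements after it.
partition : List ℕ → List ℕ
partition []       = []
partition (x ∷ xs) = (x ∸ length xs) ∷ partition xs

data _⊴_ : List ℕ → List ℕ → Set where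
  []⊴  : ∀ {Q} → [] ⊴ Q
  _∷⊴_ : ∀ {p q P Q} → p ≤ q → P ⊴ Q → (p ∷ P) ⊴ (q ∷ Q)

_≺_ : List ℕ → List ℕ → Set
β ≺ γ = partition β ⊴ partition γ

IsClosed : ℕ → ℕ → List ℕ → Set
IsClosed s t β = ∀ x → x ∈ β → (s < x → (x ∸ s) ∈ β) × (t < x → (x ∸ t) ∈ β)

InClosure : ℕ → ℕ → List ℕ → ℕ → Set
InClosure s t β y =
  ∃[ x ] ∃[ a ] ∃[ b ] (x ∈ β × a * s + b * t < x × y ≡ x ∸ (a * s + b * t))

shift : ℕ → List ℕ → List ℕ
shift k β = map (_+ k) β

IsClosureOf : ℕ → ℕ → List ℕ → List ℕ → Set
IsClosureOf s t β L = IsBetaSet L × (∀ y → y ∈ L → InClosure s t β y)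
                                  × (∀ y → InClosure s t β y → y ∈ L)

-- Since β is (s,t)-closed, an element of the closure of β + k that exceeds k already lies in
-- β + k; so that closure is β + k followed by a decreasing list R of numbers ≤ k, and likewise
-- the closure of γ + k is γ + k followed by M.  The hypotheses then say |M| ≤ |R| and
-- |β| + |R| ≤ |γ|.  Comparing the partitions position by position: on the first |β| positions
-- the inequality is that of β ≺ γ, and at position |β| + j the entry R_j ≤ k - j faces
-- γ_{|β|+j} + k with γ_{|β|+j} ≥ |γ| - |β| - j, as γ consists of distinct positive integers.
module Submission where

open import Defs
open import Data.Nat using (ℕ; _<_)
open import Data.Nat.Coprimality using (Coprime)
open import Data.List using (List; length)
open import Data.Integer using (+_; _-_) renaming (_≤_ to _≤ℤ_)
open import Data.Nat using (_≤_)

open import Data.Nat using (zero; suc; _+_; _*_; _∸_; _>_; z≤n; s≤s; s≤s⁻¹; _<?_)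
open import Data.Nat.Properties
open import Data.Nat.Tactic.RingSolver using (solve-∀)
import Data.Integer as ℤ
import Data.Integer.Properties as ℤₚ
import Data.Integer.Tactic.RingSolver as ℤ-Solver
open import Data.List using ([]; _∷_; _++_)
open import Data.List.Properties using (length-++; length-map; map-++; ++-assoc; map-id)
open import Data.List.Membership.Propositional using (_∈_)
open import Data.List.Membership.Propositional.Properties using (∈-map⁺; ∈-map⁻; ∉[])
open import Data.List.Relation.Unary.All as All using (All; []; _∷_)
import Data.List.Relation.Unary.All.Properties as All
open import Data.List.Relation.Unary.Any using (here; there)
open import Data.List.Relation.Unary.Linked as Linked using (Linked; []; [-]; _∷_)
import Data.List.Relation.Unary.Linked.Properties as Linked
import Data.List.Relation.Binary.Pointwise as Pointwise
open import Data.List.Relation.Binary.Prefix.Heterogeneous as Prefix using (Prefix; []; _∷_; _++ᵖ_; toView)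
import Data.List.Relation.Binary.Prefix.Heterogeneous.Properties as Prefix
open import Data.Product using (_×_; _,_; proj₁; proj₂; ∃-syntax)
open import Data.Empty using (⊥-elim)
open import Function using (id)
open import Algebra.Properties.CommutativeSemigroup +-commutativeSemigroup using (interchange; xy∙z≈xz∙y)
open import Relation.Binary.PropositionalEquality
open import Relation.Nullary using (yes; no)

-- ShiftedLe p q x y says x - p ≤ y - q in ℤ, i.e. without truncated subtraction.
ShiftedLe : ℕ → ℕ → ℕ → ℕ → Set
ShiftedLe p q x y = x + q ≤ y + p

ShiftedLe-suc⁺ : ∀ {p q x y} → ShiftedLe p q x y → ShiftedLe (suc p) (suc q) x y
ShiftedLe-suc⁺ {p} {q} {x} {y} h rewrite +-suc x q | +-suc y p = s≤s h

ShiftedLe-suc⁻ : ∀ {p q x y} → ShiftedLe (suc p) (suc q) x y → ShiftedLe p q x y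
ShiftedLe-suc⁻ {p} {q} {x} {y} h rewrite +-suc x q | +-suc y p = s≤s⁻¹ h

ShiftedLe⇒∸-≤ : ∀ {p q x y} → ShiftedLe p q x y → x ∸ p ≤ y ∸ q
ShiftedLe⇒∸-≤ {p} {q} {x} {y} h = begin
  x ∸ p             ≡⟨ [m+n]∸[m+o]≡n∸o q x p ⟨
  (q + x) ∸ (q + p) ≤⟨ ∸-monoˡ-≤ (q + p) (subst₂ _≤_ (+-comm x q) (+-comm y p) h) ⟩
  (p + y) ∸ (q + p) ≡⟨ cong ((p + y) ∸_) (+-comm q p) ⟩
  (p + y) ∸ (p + q) ≡⟨ [m+n]∸[m+o]≡n∸o p y q ⟩
  y ∸ q             ∎
  where open ≤-Reasoning

∸-≤⇒ShiftedLe : ∀ {p q x y} → p ≤ x → q ≤ y → x ∸ p ≤ y ∸ q → ShiftedLe p q x y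
∸-≤⇒ShiftedLe {p} {q} {x} {y} p≤x q≤y h = begin
  x + q         ≡⟨ cong (_+ q) (m∸n+n≡m p≤x) ⟨
  x ∸ p + p + q ≤⟨ +-monoˡ-≤ q (+-monoˡ-≤ p h) ⟩
  y ∸ q + p + q ≡⟨ xy∙z≈xz∙y (y ∸ q) p q ⟩
  y ∸ q + q + p ≡⟨ cong (_+ p) (m∸n+n≡m q≤y) ⟩
  y + p         ∎
  where open ≤-Reasoning

m+n<o⇒n<o∸m : ∀ m n {o} → m + n < o → n < o ∸ m
m+n<o⇒n<o∸m m n {o} h = m+n≤o⇒m≤o∸n (suc n) (subst (_≤ o) (cong suc (+-comm m n)) h)

∈-∷⁻ : ∀ {x y : ℕ} {xs} → y < x → y ∈ x ∷ xs → y ∈ xs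
∈-∷⁻ y<x (here refl) = ⊥-elim (<-irrefl refl y<x)
∈-∷⁻ _   (there y∈)  = y∈

Linked-head> : ∀ {x xs} → Linked _>_ (x ∷ xs) → All (_< x) xs
Linked-head> [-]       = []
Linked-head> (x>y ∷ l) = Linked.Linked⇒All (λ a>b b>c → <-trans b>c a>b) x>y l

head-maximum : ∀ {x y xs} → Linked _>_ (x ∷ xs) → y ∈ x ∷ xs → y ≤ x
head-maximum _ (here refl) = ≤-refl
head-maximum l (there y∈)  = <⇒≤ (All.lookup (Linked-head> l) y∈)

IsBetaSet-tail : ∀ {x xs} → IsBetaSet (x ∷ xs) → IsBetaSet xs
IsBetaSet-tail (l , _ ∷ ps) = Linked.tail l , ps

IsBetaSet-++⁻ʳ : ∀ xs {ys} → IsBetaSet (xs ++ ys) → IsBetaSet ys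
IsBetaSet-++⁻ʳ []       b = b
IsBetaSet-++⁻ʳ (_ ∷ xs) b = IsBetaSet-++⁻ʳ xs (IsBetaSet-tail b)

length<head : ∀ {x xs} → IsBetaSet (x ∷ xs) → length xs < x
length<head {xs = []}    (_ , 0<x ∷ _)      = 0<x
length<head {xs = _ ∷ _} (x>y ∷ l , _ ∷ ps) = ≤-<-trans (length<head (l , ps)) x>y

-- Position i compares X_i - (|X| - 1 - i) with Y_i - (|Y| - 1 - i); both offsets drop by one
-- per step, so the comparison is ShiftedLe |X| |Y| at every position.
≺⇒Prefix : ∀ {X Y} → IsBetaSet X → IsBetaSet Y → X ≺ Y →
           Prefix (ShiftedLe (length X) (length Y)) X Y
≺⇒Prefix {[]}             _  _  _             = []
≺⇒Prefix {_ ∷ _} {[]}     _  _  ()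
≺⇒Prefix {x ∷ X} {y ∷ Y} bX bY (h ∷⊴ X≺Y) =
  ShiftedLe-suc⁺ (∸-≤⇒ShiftedLe (<⇒≤ (length<head bX)) (<⇒≤ (length<head bY)) h)
  ∷ Prefix.map (ShiftedLe-suc⁺ {length X} {length Y})
               (≺⇒Prefix (IsBetaSet-tail bX) (IsBetaSet-tail bY) X≺Y)

Prefix⇒≺ : ∀ {X Y} → Prefix (ShiftedLe (length X) (length Y)) X Y → X ≺ Y
Prefix⇒≺ []                          = []⊴
Prefix⇒≺ {x ∷ X} {y ∷ Y} (h ∷ X⊑Y) =
  ShiftedLe⇒∸-≤ {length X} {length Y} (ShiftedLe-suc⁻ h)
  ∷⊴ Prefix⇒≺ (Prefix.map (ShiftedLe-suc⁻ {length X} {length Y}) X⊑Y)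

-- X_j ≤ k - j - 1 and Y_j ≥ |Y| - j.
<-bounded-Prefix : ∀ {k X Y} → Linked _>_ X → All (_< k) X → IsBetaSet Y → length X ≤ length Y →
                   Prefix (ShiftedLe k (suc (length Y))) X Y
<-bounded-Prefix {X = []}                _  _         _  _  = []
<-bounded-Prefix {X = _ ∷ _} {[]}        _  _         _  ()
<-bounded-Prefix {k} {x ∷ X} {y ∷ Y} lX (x<k ∷ _) bY (s≤s |X|≤|Y|) =
  head-step ∷ Prefix.map tail-step
                (<-bounded-Prefix (Linked.tail lX) (Linked-head> lX) (IsBetaSet-tail bY) |X|≤|Y|)
  where
    head-step : ShiftedLe k (suc (length (y ∷ Y))) x y
    head-step = subst₂ _≤_ (sym (+-suc x (suc (length Y)))) (+-comm k y)
                  (+-mono-≤ x<k (length<head bY))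
    tail-step : ∀ {x′ y′} → ShiftedLe x (suc (length Y)) x′ y′ →
                ShiftedLe k (suc (length (y ∷ Y))) x′ y′
    tail-step {x′} {y′} h = ≤-trans (ShiftedLe-suc⁺ {x} {suc (length Y)} {x′} {y′} h) (+-monoʳ-≤ y′ x<k)

∸-multiple∈ : ∀ {u β} → (∀ {x} → x ∈ β → u < x → x ∸ u ∈ β) →
              ∀ a {x} → x ∈ β → a * u < x → x ∸ a * u ∈ β
∸-multiple∈         step zero    x∈ _    = x∈
∸-multiple∈ {u} {β} step (suc a) {x} x∈ au<x =
  subst (_∈ β) (∸-+-assoc x u (a * u))
    (∸-multiple∈ step a (step x∈ (≤-<-trans (m≤m+n u (a * u)) au<x)) (m+n<o⇒n<o∸m u (a * u) au<x))

IsClosed-∸-combination : ∀ {s t β} → IsClosed s t β →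
                         ∀ a b {x} → x ∈ β → a * s + b * t < x → x ∸ (a * s + b * t) ∈ β
IsClosed-∸-combination {s} {t} {β} cl a b {x} x∈ w<x =
  subst (_∈ β) (∸-+-assoc x (a * s) (b * t))
    (∸-multiple∈ (λ y∈ → proj₂ (cl _ y∈)) b
      (∸-multiple∈ (λ y∈ → proj₁ (cl _ y∈)) a x∈ (≤-<-trans (m≤m+n (a * s) (b * t)) w<x))
      (m+n<o⇒n<o∸m (a * s) (b * t) w<x))

split-above : ∀ k {X Z} → Linked _>_ X → Linked _>_ Z → All (k <_) Z →
              (∀ {y} → y ∈ X → k < y → y ∈ Z) → (∀ {y} → y ∈ Z → y ∈ X) →
              ∃[ R ] X ≡ Z ++ R × All (_≤ k) R × Linked _>_ R
split-above k {X} {[]}    lX _ _ above _ =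
  X , refl , All.tabulate (λ y∈ → ≮⇒≥ (λ k<y → ∉[] (above y∈ k<y))) , lX
split-above k {[]} {_ ∷ _} _ _ _ _ below with below (here refl)
... | ()
split-above k {x ∷ X} {z ∷ Z} lX lZ (k<z ∷ k<Z) above below =
  let R , X≡Z++R , R≤k , lR = split-above k (Linked.tail lX) (Linked.tail lZ) k<Z above′ below′
  in  R , cong₂ _∷_ (≤-antisym x≤z z≤x) X≡Z++R , R≤k , lR
  where
    z≤x : z ≤ x
    z≤x = head-maximum lX (below (here refl))
    x≤z : x ≤ z
    x≤z with k <? x
    ... | yes k<x = head-maximum lZ (above (here refl) k<x)
    ... | no  k≮x = <⇒≤ (≤-<-trans (≮⇒≥ k≮x) k<z)
    above′ : ∀ {y} → y ∈ X → k < y → y ∈ Z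
    above′ y∈ k<y = ∈-∷⁻ (<-≤-trans (All.lookup (Linked-head> lX) y∈) x≤z) (above (there y∈) k<y)
    below′ : ∀ {y} → y ∈ Z → y ∈ X
    below′ y∈ = ∈-∷⁻ (<-≤-trans (All.lookup (Linked-head> lZ) y∈) z≤x) (below (there y∈))

closure-shift : ∀ {s t k β B} → IsBetaSet β → IsClosed s t β → IsClosureOf s t (shift k β) B →
                ∃[ R ] B ≡ shift k β ++ R × All (_≤ k) R × Linked _>_ R
closure-shift {s} {t} {k} {β} {B} (lβ , 0<β) cl ((lB , _) , ⊆closure , closure⊆) =
  split-above k lB (Linked.map⁺ (Linked.map (+-monoˡ-< k) lβ)) k<shift above below
  where
    k<shift : All (k <_) (shift k β)
    k<shift = All.map⁺ (All.map (+-monoˡ-< k) 0<β)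

    below : ∀ {y} → y ∈ shift k β → y ∈ B
    below y∈ = closure⊆ _ (_ , 0 , 0 , y∈ , ≤-<-trans z≤n (All.lookup k<shift y∈) , refl)

    above : ∀ {y} → y ∈ B → k < y → y ∈ shift k β
    above {y} y∈ k<y with ⊆closure y y∈
    ... | _ , a , b , x+k∈ , _ , refl with ∈-map⁻ (_+ k) x+k∈
    ... | x , x∈ , refl with a * s + b * t <? x
    ... | yes w<x = subst (_∈ shift k β) (sym (+-∸-comm k (<⇒≤ w<x)))
                      (∈-map⁺ (_+ k) (IsClosed-∸-combination cl a b x∈ w<x))
    ... | no  w≮x = ⊥-elim (<⇒≱ k<y (≤-trans (∸-monoʳ-≤ (x + k) (≮⇒≥ w≮x))
                                              (≤-reflexive (m+n∸m≡n x k))))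

length-shift-++ : ∀ k β {R : List ℕ} → length (shift k β ++ R) ≡ length β + length R
length-shift-++ k β {R} = trans (length-++ (shift k β)) (cong (_+ length R) (length-map (_+ k) β))

-- Write γ = γ₁ ++ γ₂ with |γ₁| = |β|: β + k is compared with γ₁ + k and R with γ₂ + k.
shift-++-≺ : ∀ {k β γ R} {M : List ℕ} → IsBetaSet β → IsBetaSet γ → β ≺ γ →
             Linked _>_ R → All (_≤ k) R → length M ≤ length R → length β + length R ≤ length γ →
             (shift k β ++ R) ≺ (shift k γ ++ M)
shift-++-≺ {k} {β} {γ} {R} {M} bβ bγ β≺γ lR R≤k M≤R room with toView (≺⇒Prefix bβ bγ β≺γ)
... | Prefix._++_ {γ₁} β∼γ₁ γ₂ =
  Prefix⇒≺ (subst₂ (λ p q → Prefix (ShiftedLe p q) (shift k β ++ R) (shift k (γ₁ ++ γ₂) ++ M))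
              (sym (length-shift-++ k β)) (sym (length-shift-++ k (γ₁ ++ γ₂)))
              (subst (Prefix (ShiftedLe (n + a) (m + c)) (shift k β ++ R)) C-split
                 (Prefix.++⁺ (Pointwise.map⁺ (_+ k) (_+ k) (Pointwise.map head-step β∼γ₁))
                             (tail-part ++ᵖ M))))
  where
    n = length β
    m = length (γ₁ ++ γ₂)
    a = length R
    c = length M
    g = length γ₂

    m≡n+g : m ≡ n + g
    m≡n+g = trans (length-++ γ₁) (cong (_+ g) (sym (Pointwise.Pointwise-length β∼γ₁)))

    C-split : shift k γ₁ ++ (shift k γ₂ ++ M) ≡ shift k (γ₁ ++ γ₂) ++ M
    C-split = trans (sym (++-assoc (shift k γ₁) (shift k γ₂) M))
                    (cong (_++ M) (sym (map-++ (_+ k) γ₁ γ₂)))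

    head-step : ∀ {x y} → ShiftedLe n m x y → ShiftedLe (n + a) (m + c) (x + k) (y + k)
    head-step {x} {y} h = begin
      x + k + (m + c)   ≡⟨ interchange x k m c ⟩
      x + m + (k + c)   ≤⟨ +-mono-≤ h (+-monoʳ-≤ k M≤R) ⟩
      y + n + (k + a)   ≡⟨ interchange y n k a ⟩
      y + k + (n + a)   ∎
      where open ≤-Reasoning

    tail-step : ∀ {r y} → ShiftedLe (suc k) (suc g) r y → ShiftedLe (n + a) (m + c) r (y + k)
    tail-step {r} {y} h = begin
      r + (m + c)       ≡⟨ cong (λ l → r + (l + c)) m≡n+g ⟩
      r + (n + g + c)   ≡⟨ regroup r n g c ⟩
      r + g + (n + c)   ≤⟨ +-mono-≤ (ShiftedLe-suc⁻ {k} {g} {r} {y} h) (+-monoʳ-≤ n M≤R) ⟩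
      y + k + (n + a)   ∎
      where
        open ≤-Reasoning
        regroup : ∀ r n g c → r + (n + g + c) ≡ r + g + (n + c)
        regroup = solve-∀

    a≤g : a ≤ g
    a≤g = +-cancelˡ-≤ n a g (subst (n + a ≤_) m≡n+g room)

    tail-part : Prefix (ShiftedLe (n + a) (m + c)) R (shift k γ₂)
    tail-part = subst (λ R′ → Prefix (ShiftedLe (n + a) (m + c)) R′ (shift k γ₂)) (map-id R)
      (Prefix.map⁺ id (_+ k) (Prefix.map tail-step
        (<-bounded-Prefix lR (All.map s≤s R≤k) (IsBetaSet-++⁻ʳ γ₁ bγ) a≤g)))

[m+n]-m≤[o+p]-o⇒n≤p : ∀ m n o p → + (m + n) - + m ≤ℤ + (o + p) - + o → n ≤ p
[m+n]-m≤[o+p]-o⇒n≤p m n o p h =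
  ℤₚ.drop‿+≤+ (subst₂ _≤ℤ_ (+-minus (+ m) (+ n)) (+-minus (+ o) (+ p)) h)
  where
    +-minus : ∀ x y → (x ℤ.+ y) - x ≡ y
    +-minus = ℤ-Solver.solve-∀

mainTheorem16 : (s t : ℕ) → 0 < s → s < t → Coprime s t →
    (β γ : List ℕ) → IsBetaSet β → IsBetaSet γ →
    IsClosed s t β → IsClosed s t γ →
    (k : ℕ) → 0 < k →
    (B C : List ℕ) → IsClosureOf s t (shift k β) B → IsClosureOf s t (shift k γ) C →
    β ≺ γ →
    (+ length C - + length γ) ≤ℤ (+ length B - + length β) →
    length B ≤ length γ →
    B ≺ C
mainTheorem16 _ _ _ _ _ β γ bβ bγ clβ clγ k _ _ _ closB closC β≺γ excess B≤γ
  with closure-shift bβ clβ closB | closure-shift bγ clγ closC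
... | R , refl , R≤k , lR | M , refl , _ , _ =
  shift-++-≺ bβ bγ β≺γ lR R≤k M≤R room
  where
    room : length β + length R ≤ length γ
    room = subst (_≤ length γ) (length-shift-++ k β) B≤γ

    M≤R : length M ≤ length R
    M≤R = [m+n]-m≤[o+p]-o⇒n≤p (length γ) (length M) (length β) (length R)
            (subst₂ (λ u v → + u - + length γ ≤ℤ + v - + length β)
                    (length-shift-++ k γ) (length-shift-++ k β) excess)
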